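{- Let $m$ be a positive integer, let $\Phi\subseteq\mathbf{2}^{[m]}$ be a DS-system with $\#\Phi>0$, and let $n$ be a positive integer with $\eta(\Phi)\le n$ and $n\equiv\mathrm{size}(\Phi)\pmod 2$. Then for every integer $0\le l\le n$: $\kappa_l(\mathbf{h}(\Phi;n),\mathbf{H}^{\blacktriangle}_n)=\kappa_l(\mathbf{f}(\Phi;n),\mathbf{F}^{\blacktriangle}_n)=(-1)^{n-l}f_l(\Phi;n)$; $\kappa_l(\mathbf{h}(\Phi;n),\mathbf{H}^{\blacktriangledown}_n)=\kappa_l(\mathbf{f}(\Phi;n),\mathbf{F}^{\blacktriangledown}_n)=h_l(\Phi;n)=h_{n-l}(\Phi;n)$; $\kappa_l(\mathbf{h}(\Phi;n),\mathbf{F}^{\blacktriangle}_n)=\kappa_l(\mathbf{h}(\Phi;n),\mathbf{F}^{\blacktriangledown}_n)$.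
   Context: For a positive integer $k$, $[k]=\{1,\dots,k\}$; $\#$ denotes the number of sets in a family. For $\Phi$ a family of subsets of $[k]$ and $0\le i\le k$, $f_i(\Phi;k)=\#\{F\in\Phi:|F|=i\}$, $\mathbf{f}(\Phi;k)=(f_0(\Phi;k),\dots,f_k(\Phi;k))$, and $\mathbf{h}(\Phi;k)=(h_0(\Phi;k),\dots,h_k(\Phi;k))$ is defined by $\sum_{i=0}^k h_i(\Phi;k)y^{k-i}=\sum_{i=0}^k f_i(\Phi;k)(y-1)^{k-i}$; vectors are row vectors in $\mathbb{R}^{k+1}$ indexed from $0$. If $\#\Phi>0$, $\mathrm{size}(\Phi)=\max_{F\in\Phi}|F|$. A face system $\Phi\subseteq\mathbf{2}^{[m]}$ is a DS-system if $h_l(\Phi;m)=(-1)^{m-\mathrm{size}(\Phi)}h_{m-l}(\Phi;m)$ for all $0\le l\le m$. For $\#\Phi>0$, with $u=|\bigcup_{F\in\Phi}F|$, $\eta(\Phi)=u$ if $u\equiv\mathrm{size}(\Phi)\pmod2$ and $\eta(\Phi)=u+1$ otherwise (so $\Phi\subseteq\mathbf{2}^{[n]}$ for $n\ge\eta(\Phi)$). Binomial coefficients $\binom{a}{b}$ with $a\ge0$ are $0$ when $b<0$ or $b>a$. Bases of $\mathbb{R}^{n+1}$, each consisting of vectors indexed by $i=0,\dots,n$, with $j$th component given: $\mathbf{F}^{\blacktriangle}_n$: $\binom{i}{j}$; $\mathbf{H}^{\blacktriangle}_n$: $(-1)^j\binom{n-i}{j}$; $\mathbf{F}^{\blacktriangledown}_n$: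 $\binom{i}{n-j}$; $\mathbf{H}^{\blacktriangledown}_n$: $\delta_{n-i,j}$. For a basis $\mathfrak{B}=(b_0,\dots,b_n)$ and $w\in\mathbb{R}^{n+1}$, $\kappa_0(w,\mathfrak{B}),\dots,\kappa_n(w,\mathfrak{B})$ are the unique reals with $\sum_i\kappa_i(w,\mathfrak{B})b_i=w$. -}

module Defs where

open import Data.Nat using (ℕ; zero; suc; _∸_; _⊔_; _≤_; _%_)
open import Data.Nat.Combinatorics using (_C_)
open import Data.Fin using (Fin; toℕ)
open import Data.Fin.Subset using (Subset; ⋃; ∣_∣)
open import Data.List using (List; foldr)
open import Data.Bool using (if_then_else_)
open import Data.Nat using (_≡ᵇ_)
open import Data.Product using (Σ; ∃; _×_)
open import Data.Rational using (ℚ; 0ℚ; 1ℚ; -_; _+_; _*_)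
import Data.Rational as Q
open import Relation.Binary.PropositionalEquality using (_≡_)

-- A face system on [m]: a finite family of subsets of [m] (list; distinctness is a
-- separate hypothesis in the statement).
Family : ℕ → Set
Family m = List (Subset m)

sgn : ℕ → ℚ
sgn zero = 1ℚ
sgn (suc e) = - sgn e

ℕ→ℚ : ℕ → ℚ
ℕ→ℚ k = (Data.Integer.+_ k) Q./ 1 where import Data.Integer

sumTo : ℕ → (ℕ → ℚ) → ℚ
sumTo zero g = 0ℚ
sumTo (suc k) g = sumTo k g + g k

sumFin : (k : ℕ) → (Fin k → ℚ) → ℚ
sumFin zero g = 0ℚ
sumFin (suc k) g = g Fin.zero + sumFin k (λ i → g (Fin.suc i))
  where import Data.Fin as Fin

count : ∀ {m} → Family m → ℕ → ℕ
count Φ i = foldr (λ F r → if ∣ F ∣ ≡ᵇ i then suc r else r) 0 Φ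

-- f_i(Φ;k) (independent of k for 0 ≤ i ≤ k)
fval : ∀ {m} → Family m → ℕ → ℚ
fval Φ i = ℕ→ℚ (count Φ i)

-- h_i(Φ;k): coefficient of y^{k-i} in Σ_j f_j (y-1)^{k-j}, i.e.
-- h_i = Σ_{j=0}^{i} (-1)^{i-j} C(k-j, i-j) f_j   (for 0 ≤ i ≤ k)
hval : ∀ {m} → Family m → ℕ → ℕ → ℚ
hval Φ k i = sumTo (suc i) (λ j → sgn (i ∸ j) * ℕ→ℚ ((k ∸ j) C (i ∸ j)) * fval Φ j)

fvec : ∀ {m} → Family m → (k : ℕ) → Fin (suc k) → ℚ
fvec Φ k i = fval Φ (toℕ i)

hvec : ∀ {m} → Family m → (k : ℕ) → Fin (suc k) → ℚ
hvec Φ k i = hval Φ k (toℕ i)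

size : ∀ {m} → Family m → ℕ
size Φ = foldr (λ F r → ∣ F ∣ ⊔ r) 0 Φ

IsDS : ∀ {m} → Family m → Set
IsDS {m} Φ = ∀ l → l ≤ m → hval Φ m l ≡ sgn (m ∸ size Φ) * hval Φ m (m ∸ l)

η : ∀ {m} → Family m → ℕ
η Φ = if (u % 2) ≡ᵇ (size Φ % 2) then u else suc u
  where u = ∣ ⋃ Φ ∣

-- bases of ℚ^{n+1}: B i j = j-th component of the i-th basis vector
Basis : ℕ → Set
Basis n = Fin (suc n) → Fin (suc n) → ℚ

F▲ : (n : ℕ) → Basis n
F▲ n i j = ℕ→ℚ (toℕ i C toℕ j)

H▲ : (n : ℕ) → Basis n
H▲ n i j = sgn (toℕ j) * ℕ→ℚ ((n ∸ toℕ i) C toℕ j)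

F▼ : (n : ℕ) → Basis n
F▼ n i j = ℕ→ℚ (toℕ i C (n ∸ toℕ j))

H▼ : (n : ℕ) → Basis n
H▼ n i j = if (n ∸ toℕ i) ≡ᵇ toℕ j then 1ℚ else 0ℚ

IsCoords : ∀ {n} → (Fin (suc n) → ℚ) → Basis n → (Fin (suc n) → ℚ) → Set
IsCoords {n} w B c = ∀ j → sumFin (suc n) (λ i → c i * B i j) ≡ w j

KappaIs : ∀ {n} → (Fin (suc n) → ℚ) → Basis n → Fin (suc n) → ℚ → Set
KappaIs w B l v = (∃ λ c → IsCoords w B c) × (∀ c → IsCoords w B c → c l ≡ v)

-- The map f ↦ h is linear and unitriangular, hence injective, and it sends the
-- rows of F▲ to those of H▲ and the rows of F▼ to those of H▼; so coordinates with respect to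
-- F▲, F▼ and H▲, H▼ correspond. F▲ is unitriangular, F▼ is F▲ with its columns reversed, and
-- H▲, H▼ are images of these, so all four are bases and coordinates are unique.
-- Reindexing the sum for h_{k-j} shows that the H▲-coordinates of the reversed h-vector are
-- σ_t = (-1)^{k-t} f_t. The DS condition at m thus says that (-1)^{m-s} σ are the H▲-coordinates
-- of h(Φ;m), i.e. the F▲-coordinates of f, where s = size Φ: these are the Dehn–Sommerville
-- relations f_j = Σ_t (-1)^{m-t} C(t,j) f_t, up to the sign (-1)^{m-s}. As f vanishes above s,
-- replacing m by any k ≥ s only multiplies the right-hand side by (-1)^{k-s}, so the relations
-- hold exactly in every dimension n ≥ s with n ≡ s (mod 2). They give the ▲-coordinates and
-- make h(Φ;n) palindromic, and a palindromic h is its own H▼-coordinate vector and has the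
-- same coordinates with respect to F▲ and F▼.

{-# OPTIONS --safe #-}
module Submission where

open import Defs
open import Data.Nat using (ℕ; suc; _≤_; _<_; _∸_; _%_)
open import Data.Fin using (Fin; toℕ)
open import Data.List using ([])
open import Data.List.Relation.Unary.Unique.Propositional using (Unique)
open import Data.Product using (∃; _×_)
open import Data.Rational using (ℚ; _*_)
open import Relation.Binary.PropositionalEquality using (_≡_; _≢_)

open import Algebra.Bundles using (CommutativeRing)
open import Data.Bool using (true; false; if_then_else_)
import Data.Fin as Fin
import Data.Fin.Properties as FinP
open import Data.Fin.Subset using (⋃; ∣_∣)
import Data.Fin.Subset.Properties as SubsetP
import Data.Integer as ℤ
import Data.Integer.Properties as ℤP
open import Data.List using (_∷_)
open import Data.Nat as ℕ using (zero; z≤n; s≤s; _≡ᵇ_)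
open import Data.Nat.Combinatorics using (_C_; nCk+nC[k+1]≡[n+1]C[k+1]; nCn≡1; nCk≡nC[n∸k]; k>n⇒nCk≡0)
import Data.Nat.Properties as ℕP
open import Data.Product using (_,_; proj₁; proj₂)
open import Data.Rational as ℚ using (0ℚ; 1ℚ; _+_; -_; _-_)
import Data.Rational.Properties as ℚP
open import Data.Rational.Solver using (module +-*-Solver)
import Data.Rational.Unnormalised as ℚᵘ
import Data.Rational.Unnormalised.Properties as ℚᵘP
open import Data.Sum using (inj₁; inj₂; [_,_]′)
open import Function using (_∘_)
open import Relation.Binary.PropositionalEquality using (refl; sym; trans; cong; cong₂; subst; module ≡-Reasoning)
open import Relation.Nullary using (yes; no)
open import Relation.Nullary.Decidable using (dec-true; dec-false)

open import Algebra.Properties.Group ℚP.+-0-group using (∙-cancelˡ; x∙y⁻¹≈ε⇒x≈y; ⁻¹-involutive)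
open import Algebra.Properties.Semiring.Sum (CommutativeRing.semiring ℚP.+-*-commutativeRing) using (sum-syntax; sum-cong-≗; sum-init-last; ∑-distrib-+; ∑-comm; *-distribˡ-sum)
open +-*-Solver
open ≡-Reasoning

ℕ→ℚ-+ : ∀ a b → ℕ→ℚ (a ℕ.+ b) ≡ ℕ→ℚ a + ℕ→ℚ b
ℕ→ℚ-+ a b = trans (ℚP.fromℚᵘ-cong (ℚᵘP.≃-sym toℚᵘ-sum)) (ℚP.fromℚᵘ-toℚᵘ (ℕ→ℚ a + ℕ→ℚ b))
  where
  ℕ→ℚᵘ : ℕ → ℚᵘ.ℚᵘ
  ℕ→ℚᵘ k = ℚᵘ.mkℚᵘ (ℤ.+ k) 0
  toℚᵘ-sum : ℚ.toℚᵘ (ℕ→ℚ a + ℕ→ℚ b) ℚᵘ.≃ ℕ→ℚᵘ (a ℕ.+ b)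
  toℚᵘ-sum = ℚᵘP.≃-trans (ℚP.toℚᵘ-homo-+ (ℕ→ℚ a) (ℕ→ℚ b))
    (ℚᵘP.≃-trans (ℚᵘP.+-cong (ℚP.toℚᵘ-fromℚᵘ (ℕ→ℚᵘ a)) (ℚP.toℚᵘ-fromℚᵘ (ℕ→ℚᵘ b)))
      (ℚᵘ.*≡* (cong (ℤ._* ℤ.+ 1) (trans (cong₂ ℤ._+_ (ℤP.*-identityʳ (ℤ.+ a)) (ℤP.*-identityʳ (ℤ.+ b))) (sym (ℤP.pos-+ a b))))))

ℕ→ℚ-pascal : ∀ n k → ℕ→ℚ (suc n C suc k) ≡ ℕ→ℚ (n C k) + ℕ→ℚ (n C suc k)
ℕ→ℚ-pascal n k = trans (cong ℕ→ℚ (sym (nCk+nC[k+1]≡[n+1]C[k+1] n k))) (ℕ→ℚ-+ (n C k) (n C suc k))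

sgn-+ : ∀ a b → sgn (a ℕ.+ b) ≡ sgn a * sgn b
sgn-+ zero b = sym (ℚP.*-identityˡ (sgn b))
sgn-+ (suc a) b = trans (cong -_ (sgn-+ a b)) (ℚP.neg-distribˡ-* (sgn a) (sgn b))

sgn*sgn≡1 : ∀ a → sgn a * sgn a ≡ 1ℚ
sgn*sgn≡1 zero = refl
sgn*sgn≡1 (suc a) = trans (solve 1 (λ x → (:- x) :* (:- x) := x :* x) refl (sgn a)) (sgn*sgn≡1 a)

1+n%2≢n%2 : ∀ n → suc n % 2 ≢ n % 2
1+n%2≢n%2 zero ()
1+n%2≢n%2 (suc n) eq = 1+n%2≢n%2 n (sym eq)

sgn-even : ∀ d s → (d ℕ.+ s) % 2 ≡ s % 2 → sgn d ≡ 1ℚ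
sgn-even zero s _ = refl
sgn-even (suc zero) s eq with () ← 1+n%2≢n%2 s eq
sgn-even (suc (suc d)) s eq = trans (⁻¹-involutive (sgn d)) (sgn-even d s eq)

sumTo-∑ : ∀ k (g : ℕ → ℚ) → sumTo k g ≡ ∑[ i < k ] g (toℕ i)
sumTo-∑ zero g = refl
sumTo-∑ (suc k) g = begin
  sumTo k g + g k
    ≡⟨ cong₂ _+_ (sumTo-∑ k g) (cong g (sym (FinP.toℕ-fromℕ k))) ⟩
  ∑[ i < k ] g (toℕ i) + g (toℕ (Fin.fromℕ k))
    ≡⟨ cong (_+ g (toℕ (Fin.fromℕ k))) (sum-cong-≗ {k} (λ i → cong g (sym (FinP.toℕ-inject₁ i)))) ⟩
  ∑[ i < k ] g (toℕ (Fin.inject₁ i)) + g (toℕ (Fin.fromℕ k))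
    ≡⟨ sum-init-last {k} (g ∘ toℕ) ⟨
  ∑[ i < suc k ] g (toℕ i) ∎

sumFin-∑ : ∀ k (g : Fin k → ℚ) → sumFin k g ≡ ∑[ i < k ] g i
sumFin-∑ zero g = refl
sumFin-∑ (suc k) g = cong (g Fin.zero +_) (sumFin-∑ k (g ∘ Fin.suc))

sumTo-cong : ∀ k {g g′ : ℕ → ℚ} → (∀ t → t < k → g t ≡ g′ t) → sumTo k g ≡ sumTo k g′
sumTo-cong zero eq = refl
sumTo-cong (suc k) eq = cong₂ _+_ (sumTo-cong k (λ t t<k → eq t (ℕP.m<n⇒m<1+n t<k))) (eq k ℕP.≤-refl)

sumTo-zero : ∀ k {g : ℕ → ℚ} → (∀ t → t < k → g t ≡ 0ℚ) → sumTo k g ≡ 0ℚ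
sumTo-zero zero eq = refl
sumTo-zero (suc k) eq = trans (cong₂ _+_ (sumTo-zero k (λ t t<k → eq t (ℕP.m<n⇒m<1+n t<k))) (eq k ℕP.≤-refl)) (ℚP.+-identityʳ 0ℚ)

sumTo-neg : ∀ k (g : ℕ → ℚ) → sumTo k (λ t → - g t) ≡ - sumTo k g
sumTo-neg zero g = refl
sumTo-neg (suc k) g = trans (cong (_+ - g k) (sumTo-neg k g)) (sym (ℚP.neg-distrib-+ (sumTo k g) (g k)))

sumTo-distrib-+ : ∀ k (g g′ : ℕ → ℚ) → sumTo k (λ t → g t + g′ t) ≡ sumTo k g + sumTo k g′
sumTo-distrib-+ k g g′ = begin
  sumTo k (λ t → g t + g′ t)                       ≡⟨ sumTo-∑ k _ ⟩
  ∑[ i < k ] (g (toℕ i) + g′ (toℕ i))              ≡⟨ ∑-distrib-+ {k} (g ∘ toℕ) (g′ ∘ toℕ) ⟩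
  ∑[ i < k ] g (toℕ i) + ∑[ i < k ] g′ (toℕ i)     ≡⟨ cong₂ _+_ (sumTo-∑ k g) (sumTo-∑ k g′) ⟨
  sumTo k g + sumTo k g′                           ∎

*-distribˡ-sumTo : ∀ k x (g : ℕ → ℚ) → x * sumTo k g ≡ sumTo k (λ t → x * g t)
*-distribˡ-sumTo k x g = begin
  x * sumTo k g                   ≡⟨ cong (x *_) (sumTo-∑ k g) ⟩
  x * ∑[ i < k ] g (toℕ i)        ≡⟨ *-distribˡ-sum {k} x (g ∘ toℕ) ⟩
  ∑[ i < k ] (x * g (toℕ i))      ≡⟨ sumTo-∑ k (λ t → x * g t) ⟨
  sumTo k (λ t → x * g t)         ∎

sumTo-comm : ∀ a b (G : ℕ → ℕ → ℚ) → sumTo a (λ t → sumTo b (G t)) ≡ sumTo b (λ s → sumTo a (λ t → G t s))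
sumTo-comm a b G = begin
  sumTo a (λ t → sumTo b (G t))                   ≡⟨ sumTo-∑ a _ ⟩
  ∑[ i < a ] sumTo b (G (toℕ i))                  ≡⟨ sum-cong-≗ {a} (λ i → sumTo-∑ b (G (toℕ i))) ⟩
  ∑[ i < a ] ∑[ j < b ] G (toℕ i) (toℕ j)         ≡⟨ ∑-comm {a} {b} (λ i j → G (toℕ i) (toℕ j)) ⟩
  ∑[ j < b ] ∑[ i < a ] G (toℕ i) (toℕ j)         ≡⟨ sum-cong-≗ {b} (λ j → sumTo-∑ a (λ t → G t (toℕ j))) ⟨
  ∑[ j < b ] sumTo a (λ t → G t (toℕ j))          ≡⟨ sumTo-∑ b _ ⟨
  sumTo b (λ s → sumTo a (λ t → G t s))           ∎

sumTo-suc : ∀ k (g : ℕ → ℚ) → sumTo (suc k) g ≡ g 0 + sumTo k (g ∘ suc)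
sumTo-suc k g = trans (sumTo-∑ (suc k) g) (cong (g 0 +_) (sym (sumTo-∑ k (g ∘ suc))))

sumTo-vanishing-tail : ∀ {a b} (g : ℕ → ℚ) → b ≤ a → (∀ t → b ≤ t → t < a → g t ≡ 0ℚ) → sumTo a g ≡ sumTo b g
sumTo-vanishing-tail {a} {b} g b≤a tail with ℕP.m≤n⇒m<n∨m≡n b≤a
sumTo-vanishing-tail {suc a} {b} g _ tail | inj₁ b<1+a = begin
  sumTo a g + g a     ≡⟨ cong (sumTo a g +_) (tail a (ℕ.s≤s⁻¹ b<1+a) ℕP.≤-refl) ⟩
  sumTo a g + 0ℚ      ≡⟨ ℚP.+-identityʳ (sumTo a g) ⟩
  sumTo a g           ≡⟨ sumTo-vanishing-tail g (ℕ.s≤s⁻¹ b<1+a) (λ t b≤t t<a → tail t b≤t (ℕP.m<n⇒m<1+n t<a)) ⟩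
  sumTo b g           ∎
... | inj₂ refl = refl

sumTo-single : ∀ k {g : ℕ → ℚ} u → u < k → (∀ t → t < k → t ≢ u → g t ≡ 0ℚ) → sumTo k g ≡ g u
sumTo-single (suc k) {g} u u<1+k off with u ℕP.≟ k
... | yes refl = begin
  sumTo k g + g k     ≡⟨ cong (_+ g k) (sumTo-zero k (λ t t<k → off t (ℕP.m<n⇒m<1+n t<k) (λ { refl → ℕP.<-irrefl refl t<k }))) ⟩
  0ℚ + g k            ≡⟨ ℚP.+-identityˡ (g k) ⟩
  g k                 ∎
... | no u≢k = begin
  sumTo k g + g k     ≡⟨ cong (sumTo k g +_) (off k ℕP.≤-refl (u≢k ∘ sym)) ⟩
  sumTo k g + 0ℚ      ≡⟨ ℚP.+-identityʳ (sumTo k g) ⟩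
  sumTo k g           ≡⟨ sumTo-single k u (ℕP.≤∧≢⇒< (ℕ.s≤s⁻¹ u<1+k) u≢k) (λ t t<k → off t (ℕP.m<n⇒m<1+n t<k)) ⟩
  g u                 ∎

≤-suc-cases : ∀ {P : ℕ → Set} {n} → (∀ j → j ≤ n → P j) → P (suc n) → ∀ j → j ≤ suc n → P j
≤-suc-cases below top j j≤1+n with ℕP.m≤n⇒m<n∨m≡n j≤1+n
... | inj₁ j<1+n = below j (ℕ.s≤s⁻¹ j<1+n)
... | inj₂ refl = top

-- Coordinates with respect to a basis

-- The ℕ-indexed form of IsCoords; a record rather than a function so that its indices can be inferred.
record Coords (n : ℕ) (w : ℕ → ℚ) (b : ℕ → ℕ → ℚ) (c : ℕ → ℚ) : Set where
  constructor coords
  field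
    at : ∀ j → j ≤ n → sumTo (suc n) (λ t → c t * b t j) ≡ w j

open Coords

Independent : ℕ → (ℕ → ℕ → ℚ) → Set
Independent n b = ∀ d → Coords n (λ _ → 0ℚ) b d → ∀ t → t ≤ n → d t ≡ 0ℚ

Coords-congʷ : ∀ {n w w′ b c} → (∀ j → j ≤ n → w j ≡ w′ j) → Coords n w b c → Coords n w′ b c
Coords-congʷ eq hc .at j j≤n = trans (hc .at j j≤n) (eq j j≤n)

Coords-congᶜ : ∀ {n w b c c′} → (∀ t → t ≤ n → c t ≡ c′ t) → Coords n w b c → Coords n w b c′
Coords-congᶜ {n} eq hc .at j j≤n = trans (sumTo-cong (suc n) (λ t t≤n → cong (_* _) (sym (eq t (ℕ.s≤s⁻¹ t≤n))))) (hc .at j j≤n)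

Coords-scale : ∀ {n w b c} x → Coords n w b c → Coords n (λ j → x * w j) b (λ t → x * c t)
Coords-scale {n} {w} {b} {c} x hc .at j j≤n = begin
  sumTo (suc n) (λ t → x * c t * b t j)     ≡⟨ sumTo-cong (suc n) (λ t _ → ℚP.*-assoc x (c t) (b t j)) ⟩
  sumTo (suc n) (λ t → x * (c t * b t j))   ≡⟨ *-distribˡ-sumTo (suc n) x _ ⟨
  x * sumTo (suc n) (λ t → c t * b t j)     ≡⟨ cong (x *_) (hc .at j j≤n) ⟩
  x * w j                                   ∎

Independent⇒coords-unique : ∀ {n w b c c′} → Independent n b → Coords n w b c → Coords n w b c′ →
  ∀ t → t ≤ n → c t ≡ c′ t
Independent⇒coords-unique {n} {w} {b} {c} {c′} independent hc hc′ t t≤n =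
  x∙y⁻¹≈ε⇒x≈y (c t) (c′ t) (independent (λ t → c t - c′ t) difference t t≤n)
  where
  difference : Coords n (λ _ → 0ℚ) b (λ t → c t - c′ t)
  difference .at j j≤n = begin
    sumTo (suc n) (λ t → (c t - c′ t) * b t j)
      ≡⟨ sumTo-cong (suc n) (λ t _ → solve 3 (λ x y z → (x :- y) :* z := x :* z :+ (:- (y :* z))) refl (c t) (c′ t) (b t j)) ⟩
    sumTo (suc n) (λ t → c t * b t j + - (c′ t * b t j))
      ≡⟨ sumTo-distrib-+ (suc n) _ _ ⟩
    sumTo (suc n) (λ t → c t * b t j) + sumTo (suc n) (λ t → - (c′ t * b t j))
      ≡⟨ cong₂ _+_ (hc .at j j≤n) (trans (sumTo-neg (suc n) _) (cong -_ (hc′ .at j j≤n))) ⟩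
    w j - w j
      ≡⟨ ℚP.+-inverseʳ (w j) ⟩
    0ℚ ∎

-- ℕ-indexed rows of the four bases: F▲ n i j ≡ F▲ℕ (toℕ i) (toℕ j), and so on, by definition.
F▲ℕ : ℕ → ℕ → ℚ
F▲ℕ t j = ℕ→ℚ (t C j)

F▼ℕ : ℕ → ℕ → ℕ → ℚ
F▼ℕ n t j = ℕ→ℚ (t C (n ∸ j))

H▲ℕ : ℕ → ℕ → ℕ → ℚ
H▲ℕ n t j = sgn j * ℕ→ℚ ((n ∸ t) C j)

H▼ℕ : ℕ → ℕ → ℕ → ℚ
H▼ℕ n t j = if (n ∸ t) ≡ᵇ j then 1ℚ else 0ℚ

F▲ℕ-last-column : ∀ n (c : ℕ → ℚ) → sumTo (suc n) (λ t → c t * F▲ℕ t n) ≡ c n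
F▲ℕ-last-column n c = begin
  sumTo n (λ t → c t * F▲ℕ t n) + c n * F▲ℕ n n   ≡⟨ cong₂ _+_ (sumTo-zero n above-diagonal) diagonal ⟩
  0ℚ + c n                                        ≡⟨ ℚP.+-identityˡ (c n) ⟩
  c n                                             ∎
  where
  above-diagonal : ∀ t → t < n → c t * F▲ℕ t n ≡ 0ℚ
  above-diagonal t t<n = trans (cong (λ x → c t * ℕ→ℚ x) (k>n⇒nCk≡0 t<n)) (ℚP.*-zeroʳ (c t))
  diagonal : c n * F▲ℕ n n ≡ c n
  diagonal = trans (cong (λ x → c n * ℕ→ℚ x) (nCn≡1 n)) (ℚP.*-identityʳ (c n))

F▲ℕ-last-coefficient : ∀ {n w c} → Coords n w F▲ℕ c → c n ≡ w n
F▲ℕ-last-coefficient {n} {w} {c} hc = trans (sym (F▲ℕ-last-column n c)) (hc .at n ℕP.≤-refl)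

F▲ℕ-independent : ∀ n → Independent n F▲ℕ
F▲ℕ-independent zero d hd .zero z≤n = F▲ℕ-last-coefficient hd
F▲ℕ-independent (suc n) d hd = ≤-suc-cases (F▲ℕ-independent n d lower) (F▲ℕ-last-coefficient hd)
  where
  lower : Coords n (λ _ → 0ℚ) F▲ℕ d
  lower .at j j≤n = begin
    sumTo (suc n) (λ t → d t * F▲ℕ t j)                              ≡⟨ ℚP.+-identityʳ _ ⟨
    sumTo (suc n) (λ t → d t * F▲ℕ t j) + 0ℚ                         ≡⟨ cong (sumTo (suc n) (λ t → d t * F▲ℕ t j) +_) d[1+n]*F▲≡0 ⟨
    sumTo (suc n) (λ t → d t * F▲ℕ t j) + d (suc n) * F▲ℕ (suc n) j  ≡⟨ hd .at j (ℕP.m≤n⇒m≤1+n j≤n) ⟩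
    0ℚ                                                               ∎
    where
    d[1+n]*F▲≡0 : d (suc n) * F▲ℕ (suc n) j ≡ 0ℚ
    d[1+n]*F▲≡0 = trans (cong (_* F▲ℕ (suc n) j) (F▲ℕ-last-coefficient hd)) (ℚP.*-zeroˡ (F▲ℕ (suc n) j))

F▲ℕ-coords-exist : ∀ n w → ∃ (Coords n w F▲ℕ)
F▲ℕ-coords-exist zero w = (λ _ → w 0) , coords λ { zero z≤n → F▲ℕ-last-column 0 (λ _ → w 0) }
F▲ℕ-coords-exist (suc n) w = c , combination
  where
  w′ : ℕ → ℚ
  w′ j = w j - w (suc n) * F▲ℕ (suc n) j
  c′ : ℕ → ℚ
  c′ = proj₁ (F▲ℕ-coords-exist n w′)
  c : ℕ → ℚ
  c t = if t ≡ᵇ suc n then w (suc n) else c′ t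
  c-top : c (suc n) ≡ w (suc n)
  c-top = cong (λ b → if b then w (suc n) else c′ (suc n)) (dec-true (suc n ℕ.≟ suc n) refl)
  c-below : ∀ t → t < suc n → c t ≡ c′ t
  c-below t t<1+n = cong (λ b → if b then w (suc n) else c′ t) (dec-false (t ℕ.≟ suc n) (λ { refl → ℕP.<-irrefl refl t<1+n }))
  combination : Coords (suc n) w F▲ℕ c
  combination .at = ≤-suc-cases lower (trans (F▲ℕ-last-column (suc n) c) c-top)
    where
    lower : ∀ j → j ≤ n → sumTo (suc (suc n)) (λ t → c t * F▲ℕ t j) ≡ w j
    lower j j≤n = begin
      sumTo (suc n) (λ t → c t * F▲ℕ t j) + c (suc n) * F▲ℕ (suc n) j
        ≡⟨ cong₂ _+_ (sumTo-cong (suc n) (λ t t<1+n → cong (_* F▲ℕ t j) (c-below t t<1+n))) (cong (_* F▲ℕ (suc n) j) c-top) ⟩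
      sumTo (suc n) (λ t → c′ t * F▲ℕ t j) + w (suc n) * F▲ℕ (suc n) j
        ≡⟨ cong (_+ w (suc n) * F▲ℕ (suc n) j) (proj₂ (F▲ℕ-coords-exist n w′) .at j j≤n) ⟩
      w′ j + w (suc n) * F▲ℕ (suc n) j
        ≡⟨ solve 2 (λ x y → (x :- y) :+ y := x) refl (w j) (w (suc n) * F▲ℕ (suc n) j) ⟩
      w j ∎

Coords-F▼ℕ : ∀ {n w c} → Coords n (λ j → w (n ∸ j)) F▲ℕ c → Coords n w (F▼ℕ n) c
Coords-F▼ℕ {n} {w} hc .at j j≤n = trans (hc .at (n ∸ j) (ℕP.m∸n≤m n j)) (cong w (ℕP.m∸[m∸n]≡n j≤n))

Coords-F▼ℕ⁻¹ : ∀ {n w c} → Coords n w (F▼ℕ n) c → Coords n (λ j → w (n ∸ j)) F▲ℕ c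
Coords-F▼ℕ⁻¹ {n} {w} {c} hc .at j j≤n =
  trans (cong (λ i → sumTo (suc n) (λ t → c t * F▲ℕ t i)) (sym (ℕP.m∸[m∸n]≡n j≤n))) (hc .at (n ∸ j) (ℕP.m∸n≤m n j))

F▼ℕ-independent : ∀ n → Independent n (F▼ℕ n)
F▼ℕ-independent n d hd = F▲ℕ-independent n d (Coords-F▼ℕ⁻¹ hd)

H▼ℕ-coords-reverse : ∀ n w → Coords n w (H▼ℕ n) (λ t → w (n ∸ t))
H▼ℕ-coords-reverse n w .at j j≤n = begin
  sumTo (suc n) (λ t → w (n ∸ t) * H▼ℕ n t j)
    ≡⟨ sumTo-single (suc n) (n ∸ j) (s≤s (ℕP.m∸n≤m n j)) off-diagonal ⟩
  w (n ∸ (n ∸ j)) * H▼ℕ n (n ∸ j) j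
    ≡⟨ cong (λ u → w u * (if u ≡ᵇ j then 1ℚ else 0ℚ)) (ℕP.m∸[m∸n]≡n j≤n) ⟩
  w j * (if j ≡ᵇ j then 1ℚ else 0ℚ)
    ≡⟨ cong (λ b → w j * (if b then 1ℚ else 0ℚ)) (dec-true (j ℕ.≟ j) refl) ⟩
  w j * 1ℚ
    ≡⟨ ℚP.*-identityʳ (w j) ⟩
  w j ∎
  where
  off-diagonal : ∀ t → t < suc n → t ≢ n ∸ j → w (n ∸ t) * H▼ℕ n t j ≡ 0ℚ
  off-diagonal t t<1+n t≢n∸j = trans (cong (λ b → w (n ∸ t) * (if b then 1ℚ else 0ℚ)) (dec-false ((n ∸ t) ℕ.≟ j) n∸t≢j)) (ℚP.*-zeroʳ (w (n ∸ t)))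
    where
    n∸t≢j : n ∸ t ≢ j
    n∸t≢j refl = t≢n∸j (sym (ℕP.m∸[m∸n]≡n (ℕ.s≤s⁻¹ t<1+n)))

-- The transform from f-vectors to h-vectors

hCoeff : ℕ → ℕ → ℕ → ℚ
hCoeff k j t = sgn (j ∸ t) * ℕ→ℚ ((k ∸ t) C (j ∸ t))

-- hval Φ k is f→h k (fval Φ) by definition.
f→h : ℕ → (ℕ → ℚ) → ℕ → ℚ
f→h k g j = sumTo (suc j) (λ t → hCoeff k j t * g t)

f→h-cong : ∀ k j {g g′ : ℕ → ℚ} → (∀ t → t ≤ j → g t ≡ g′ t) → f→h k g j ≡ f→h k g′ j
f→h-cong k j eq = sumTo-cong (suc j) (λ t t≤j → cong (hCoeff k j t *_) (eq t (ℕ.s≤s⁻¹ t≤j)))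

f→h-at-0 : ∀ k (g : ℕ → ℚ) → f→h k g 0 ≡ g 0
f→h-at-0 k g = trans (ℚP.+-identityˡ (1ℚ * g 0)) (ℚP.*-identityˡ (g 0))

f→h-last : ∀ k (g : ℕ → ℚ) j → f→h k g j ≡ sumTo j (λ t → hCoeff k j t * g t) + g j
f→h-last k g j = cong (sumTo j (λ t → hCoeff k j t * g t) +_) (trans (cong (λ i → sgn i * ℕ→ℚ ((k ∸ j) C i) * g j) (ℕP.n∸n≡0 j)) (ℚP.*-identityˡ (g j)))

f→h-shift : ∀ k (g : ℕ → ℚ) j → g 0 ≡ 0ℚ → f→h (suc k) g (suc j) ≡ f→h k (g ∘ suc) j
f→h-shift k g j g0≡0 = begin
  f→h (suc k) g (suc j)                                           ≡⟨ sumTo-suc (suc j) _ ⟩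
  hCoeff (suc k) (suc j) 0 * g 0 + f→h k (g ∘ suc) j              ≡⟨ cong (λ x → hCoeff (suc k) (suc j) 0 * x + f→h k (g ∘ suc) j) g0≡0 ⟩
  hCoeff (suc k) (suc j) 0 * 0ℚ + f→h k (g ∘ suc) j               ≡⟨ cong (_+ f→h k (g ∘ suc) j) (ℚP.*-zeroʳ (hCoeff (suc k) (suc j) 0)) ⟩
  0ℚ + f→h k (g ∘ suc) j                                          ≡⟨ ℚP.+-identityˡ (f→h k (g ∘ suc) j) ⟩
  f→h k (g ∘ suc) j                                               ∎

f→h-+ : ∀ k j (g g′ : ℕ → ℚ) → f→h k (λ t → g t + g′ t) j ≡ f→h k g j + f→h k g′ j
f→h-+ k j g g′ = trans (sumTo-cong (suc j) (λ t _ → ℚP.*-distribˡ-+ (hCoeff k j t) (g t) (g′ t))) (sumTo-distrib-+ (suc j) _ _)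

f→h-of-0 : ∀ k j → f→h k (λ _ → 0ℚ) j ≡ 0ℚ
f→h-of-0 k j = sumTo-zero (suc j) (λ t _ → ℚP.*-zeroʳ (hCoeff k j t))

f→h-linear : ∀ k j N (c : ℕ → ℚ) (b : ℕ → ℕ → ℚ) →
  f→h k (λ s → sumTo N (λ t → c t * b t s)) j ≡ sumTo N (λ t → c t * f→h k (b t) j)
f→h-linear k j N c b = begin
  sumTo (suc j) (λ s → hCoeff k j s * sumTo N (λ t → c t * b t s))
    ≡⟨ sumTo-cong (suc j) (λ s _ → *-distribˡ-sumTo N (hCoeff k j s) _) ⟩
  sumTo (suc j) (λ s → sumTo N (λ t → hCoeff k j s * (c t * b t s)))
    ≡⟨ sumTo-comm (suc j) N _ ⟩
  sumTo N (λ t → sumTo (suc j) (λ s → hCoeff k j s * (c t * b t s)))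
    ≡⟨ sumTo-cong N (λ t _ → sumTo-cong (suc j) (λ s _ → solve 3 (λ x y z → x :* (y :* z) := y :* (x :* z)) refl (hCoeff k j s) (c t) (b t s))) ⟩
  sumTo N (λ t → sumTo (suc j) (λ s → c t * (hCoeff k j s * b t s)))
    ≡⟨ sumTo-cong N (λ t _ → *-distribˡ-sumTo (suc j) (c t) _) ⟨
  sumTo N (λ t → c t * f→h k (b t) j) ∎

f→h-injective : ∀ k n {g g′ : ℕ → ℚ} → (∀ j → j ≤ n → f→h k g j ≡ f→h k g′ j) → ∀ j → j ≤ n → g j ≡ g′ j
f→h-injective k zero {g} {g′} eq .zero z≤n = begin
  g 0            ≡⟨ f→h-at-0 k g ⟨
  f→h k g 0      ≡⟨ eq 0 z≤n ⟩
  f→h k g′ 0     ≡⟨ f→h-at-0 k g′ ⟩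
  g′ 0           ∎
f→h-injective k (suc n) {g} {g′} eq = ≤-suc-cases below (∙-cancelˡ (lower g) (g (suc n)) (g′ (suc n)) (begin
  lower g + g (suc n)      ≡⟨ f→h-last k g (suc n) ⟨
  f→h k g (suc n)          ≡⟨ eq (suc n) ℕP.≤-refl ⟩
  f→h k g′ (suc n)         ≡⟨ f→h-last k g′ (suc n) ⟩
  lower g′ + g′ (suc n)    ≡⟨ cong (_+ g′ (suc n)) (sumTo-cong (suc n) (λ t t<1+n → cong (hCoeff k (suc n) t *_) (below t (ℕ.s≤s⁻¹ t<1+n)))) ⟨
  lower g + g′ (suc n)     ∎))
  where
  lower : (ℕ → ℚ) → ℚ
  lower h = sumTo (suc n) (λ t → hCoeff k (suc n) t * h t)
  below : ∀ j → j ≤ n → g j ≡ g′ j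
  below = f→h-injective k n (λ j j≤n → eq j (ℕP.m≤n⇒m≤1+n j≤n))

f→h-Rows : ℕ → (ℕ → ℕ → ℚ) → (ℕ → ℕ → ℚ) → Set
f→h-Rows n b b′ = ∀ t j → t ≤ n → j ≤ n → f→h n (b t) j ≡ b′ t j

Coords-f→h : ∀ {n b b′ g c} → f→h-Rows n b b′ → Coords n g b c → Coords n (f→h n g) b′ c
Coords-f→h {n} {b} {b′} {g} {c} rows hc .at j j≤n = begin
  sumTo (suc n) (λ t → c t * b′ t j)                ≡⟨ sumTo-cong (suc n) (λ t t≤n → cong (c t *_) (sym (rows t j (ℕ.s≤s⁻¹ t≤n) j≤n))) ⟩
  sumTo (suc n) (λ t → c t * f→h n (b t) j)         ≡⟨ f→h-linear n j (suc n) c b ⟨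
  f→h n (λ s → sumTo (suc n) (λ t → c t * b t s)) j ≡⟨ f→h-cong n j (λ s s≤j → hc .at s (ℕP.≤-trans s≤j j≤n)) ⟩
  f→h n g j                                         ∎

Coords-f→h⁻¹ : ∀ {n b b′ g c} → f→h-Rows n b b′ → Coords n (f→h n g) b′ c → Coords n g b c
Coords-f→h⁻¹ {n} {b} {b′} {g} {c} rows hc .at = f→h-injective n n λ j j≤n → begin
  f→h n (λ s → sumTo (suc n) (λ t → c t * b t s)) j ≡⟨ f→h-linear n j (suc n) c b ⟩
  sumTo (suc n) (λ t → c t * f→h n (b t) j)         ≡⟨ sumTo-cong (suc n) (λ t t≤n → cong (c t *_) (rows t j (ℕ.s≤s⁻¹ t≤n) j≤n)) ⟩
  sumTo (suc n) (λ t → c t * b′ t j)                ≡⟨ hc .at j j≤n ⟩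
  f→h n g j                                         ∎

Independent-f→h : ∀ {n b b′} → f→h-Rows n b b′ → Independent n b → Independent n b′
Independent-f→h {n} rows independent d hd =
  independent d (Coords-f→h⁻¹ rows (Coords-congʷ (λ j _ → sym (f→h-of-0 n j)) hd))

shiftʳ : (ℕ → ℚ) → ℕ → ℚ
shiftʳ g zero = 0ℚ
shiftʳ g (suc t) = g t

F▲ℕ-pascal : ∀ i t → F▲ℕ (suc i) t ≡ shiftʳ (F▲ℕ i) t + F▲ℕ i t
F▲ℕ-pascal i zero = refl
F▲ℕ-pascal i (suc t) = ℕ→ℚ-pascal i t

f→h-binomial : ∀ {k i} → i ≤ k → ∀ j → f→h k (F▲ℕ i) j ≡ H▲ℕ k i j
f→h-binomial {k} {zero} _ j = begin
  f→h k (F▲ℕ 0) j                                                  ≡⟨ sumTo-suc j _ ⟩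
  hCoeff k j 0 * 1ℚ + sumTo j (λ t → hCoeff k j (suc t) * 0ℚ)      ≡⟨ cong₂ _+_ (ℚP.*-identityʳ (hCoeff k j 0)) (sumTo-zero j (λ t _ → ℚP.*-zeroʳ (hCoeff k j (suc t)))) ⟩
  hCoeff k j 0 + 0ℚ                                                ≡⟨ ℚP.+-identityʳ (hCoeff k j 0) ⟩
  H▲ℕ k 0 j                                                        ∎
f→h-binomial {suc k} {suc i} (s≤s i≤k) zero = f→h-at-0 (suc k) (F▲ℕ (suc i))
f→h-binomial {suc k} {suc i} (s≤s i≤k) (suc j) = begin
  f→h (suc k) (F▲ℕ (suc i)) (suc j)
    ≡⟨ f→h-cong (suc k) (suc j) (λ t _ → F▲ℕ-pascal i t) ⟩
  f→h (suc k) (λ t → shiftʳ (F▲ℕ i) t + F▲ℕ i t) (suc j)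
    ≡⟨ f→h-+ (suc k) (suc j) (shiftʳ (F▲ℕ i)) (F▲ℕ i) ⟩
  f→h (suc k) (shiftʳ (F▲ℕ i)) (suc j) + f→h (suc k) (F▲ℕ i) (suc j)
    ≡⟨ cong₂ _+_ (trans (f→h-shift k (shiftʳ (F▲ℕ i)) j refl) (f→h-binomial i≤k j)) (f→h-binomial (ℕP.m≤n⇒m≤1+n i≤k) (suc j)) ⟩
  sgn j * ℕ→ℚ ((k ∸ i) C j) + - sgn j * ℕ→ℚ ((suc k ∸ i) C suc j)
    ≡⟨ cong (λ a → sgn j * ℕ→ℚ ((k ∸ i) C j) + - sgn j * ℕ→ℚ (a C suc j)) (ℕP.+-∸-assoc 1 i≤k) ⟩
  sgn j * ℕ→ℚ ((k ∸ i) C j) + - sgn j * ℕ→ℚ (suc (k ∸ i) C suc j)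
    ≡⟨ cong (λ x → sgn j * ℕ→ℚ ((k ∸ i) C j) + - sgn j * x) (ℕ→ℚ-pascal (k ∸ i) j) ⟩
  sgn j * ℕ→ℚ ((k ∸ i) C j) + - sgn j * (ℕ→ℚ ((k ∸ i) C j) + ℕ→ℚ ((k ∸ i) C suc j))
    ≡⟨ solve 3 (λ s a b → s :* a :+ (:- s) :* (a :+ b) := (:- s) :* b) refl (sgn j) (ℕ→ℚ ((k ∸ i) C j)) (ℕ→ℚ ((k ∸ i) C suc j)) ⟩
  H▲ℕ (suc k) (suc i) (suc j) ∎

f→h-F▲ℕ : ∀ n → f→h-Rows n F▲ℕ (H▲ℕ n)
f→h-F▲ℕ n t j t≤n _ = f→h-binomial t≤n j

-- Induction on d = n ∸ t: for d > 0 the row vanishes at index 0, so f→h-shift applies.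
f→h-F▼ℕ-offset : ∀ d t j → j ≤ d ℕ.+ t → f→h (d ℕ.+ t) (F▼ℕ (d ℕ.+ t) t) j ≡ (if d ≡ᵇ j then 1ℚ else 0ℚ)
f→h-F▼ℕ-offset zero t j j≤t = begin
  f→h t (F▼ℕ t t) j                 ≡⟨ f→h-cong t j (λ s s≤j → cong ℕ→ℚ (sym (nCk≡nC[n∸k] (ℕP.≤-trans s≤j j≤t)))) ⟩
  f→h t (F▲ℕ t) j                   ≡⟨ f→h-binomial ℕP.≤-refl j ⟩
  sgn j * ℕ→ℚ ((t ∸ t) C j)         ≡⟨ cong (λ a → sgn j * ℕ→ℚ (a C j)) (ℕP.n∸n≡0 t) ⟩
  sgn j * ℕ→ℚ (0 C j)               ≡⟨ sgn*0Cj j ⟩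
  (if 0 ≡ᵇ j then 1ℚ else 0ℚ)       ∎
  where
  sgn*0Cj : ∀ j → sgn j * ℕ→ℚ (0 C j) ≡ (if 0 ≡ᵇ j then 1ℚ else 0ℚ)
  sgn*0Cj zero = refl
  sgn*0Cj (suc j) = ℚP.*-zeroʳ (sgn (suc j))
f→h-F▼ℕ-offset (suc d) t zero _ = trans (f→h-at-0 (suc (d ℕ.+ t)) (F▼ℕ (suc (d ℕ.+ t)) t)) (cong ℕ→ℚ (k>n⇒nCk≡0 (s≤s (ℕP.m≤n+m t d))))
f→h-F▼ℕ-offset (suc d) t (suc j) (s≤s j≤d+t) =
  trans (f→h-shift (d ℕ.+ t) (F▼ℕ (suc (d ℕ.+ t)) t) j (cong ℕ→ℚ (k>n⇒nCk≡0 (s≤s (ℕP.m≤n+m t d))))) (f→h-F▼ℕ-offset d t j j≤d+t)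

f→h-F▼ℕ : ∀ n → f→h-Rows n (F▼ℕ n) (H▼ℕ n)
f→h-F▼ℕ n t j t≤n j≤n =
  subst (λ k → f→h k (F▼ℕ k t) j ≡ H▼ℕ n t j) (ℕP.m∸n+n≡m t≤n)
    (f→h-F▼ℕ-offset (n ∸ t) t j (subst (j ≤_) (sym (ℕP.m∸n+n≡m t≤n)) j≤n))

H▲ℕ-independent : ∀ n → Independent n (H▲ℕ n)
H▲ℕ-independent n = Independent-f→h (f→h-F▲ℕ n) (F▲ℕ-independent n)

H▼ℕ-independent : ∀ n → Independent n (H▼ℕ n)
H▼ℕ-independent n = Independent-f→h (f→h-F▼ℕ n) (F▼ℕ-independent n)

alt : ℕ → (ℕ → ℚ) → ℕ → ℚ
alt n f t = sgn (n ∸ t) * f t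

f→h-reverse : ∀ k (g : ℕ → ℚ) → Coords k (λ j → f→h k g (k ∸ j)) (H▲ℕ k) (alt k g)
f→h-reverse k g .at j j≤k = begin
  sumTo (suc k) (λ t → alt k g t * H▲ℕ k t j)          ≡⟨ sumTo-vanishing-tail _ (s≤s (ℕP.m∸n≤m k j)) beyond ⟩
  sumTo (suc (k ∸ j)) (λ t → alt k g t * H▲ℕ k t j)    ≡⟨ sumTo-cong (suc (k ∸ j)) (λ t t≤k∸j → term t (ℕ.s≤s⁻¹ t≤k∸j)) ⟩
  f→h k g (k ∸ j)                                      ∎
  where
  beyond : ∀ t → suc (k ∸ j) ≤ t → t < suc k → alt k g t * H▲ℕ k t j ≡ 0ℚ
  beyond t k∸j<t t≤k = begin
    alt k g t * (sgn j * ℕ→ℚ ((k ∸ t) C j))   ≡⟨ cong (λ x → alt k g t * (sgn j * ℕ→ℚ x)) (k>n⇒nCk≡0 k∸t<j) ⟩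
    alt k g t * (sgn j * 0ℚ)                  ≡⟨ cong (alt k g t *_) (ℚP.*-zeroʳ (sgn j)) ⟩
    alt k g t * 0ℚ                            ≡⟨ ℚP.*-zeroʳ (alt k g t) ⟩
    0ℚ                                        ∎
    where
    k∸t<j : k ∸ t < j
    k∸t<j = subst (k ∸ t <_) (ℕP.m∸[m∸n]≡n j≤k) (ℕP.∸-monoʳ-< k∸j<t (ℕ.s≤s⁻¹ t≤k))
  term : ∀ t → t ≤ k ∸ j → alt k g t * H▲ℕ k t j ≡ hCoeff k (k ∸ j) t * g t
  term t t≤k∸j = begin
    sgn (k ∸ t) * g t * (sgn j * ℕ→ℚ ((k ∸ t) C j))
      ≡⟨ cong₂ (λ x y → sgn x * g t * (sgn j * ℕ→ℚ y)) (sym (ℕP.m∸n+n≡m j≤k∸t)) (nCk≡nC[n∸k] j≤k∸t) ⟩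
    sgn (a ℕ.+ j) * g t * (sgn j * ℕ→ℚ ((k ∸ t) C a))
      ≡⟨ cong (λ x → x * g t * (sgn j * ℕ→ℚ ((k ∸ t) C a))) (sgn-+ a j) ⟩
    sgn a * sgn j * g t * (sgn j * ℕ→ℚ ((k ∸ t) C a))
      ≡⟨ solve 4 (λ x y z w → x :* y :* z :* (y :* w) := y :* y :* (x :* w :* z)) refl (sgn a) (sgn j) (g t) (ℕ→ℚ ((k ∸ t) C a)) ⟩
    sgn j * sgn j * (sgn a * ℕ→ℚ ((k ∸ t) C a) * g t)
      ≡⟨ cong (_* (sgn a * ℕ→ℚ ((k ∸ t) C a) * g t)) (sgn*sgn≡1 j) ⟩
    1ℚ * (sgn a * ℕ→ℚ ((k ∸ t) C a) * g t)
      ≡⟨ ℚP.*-identityˡ _ ⟩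
    sgn a * ℕ→ℚ ((k ∸ t) C a) * g t
      ≡⟨ cong (λ x → sgn x * ℕ→ℚ ((k ∸ t) C x) * g t) (sym k∸j∸t≡a) ⟩
    hCoeff k (k ∸ j) t * g t ∎
    where
    a : ℕ
    a = (k ∸ t) ∸ j
    j≤k∸t : j ≤ k ∸ t
    j≤k∸t = subst (_≤ k ∸ t) (ℕP.m∸[m∸n]≡n j≤k) (ℕP.∸-monoʳ-≤ k t≤k∸j)
    k∸j∸t≡a : (k ∸ j) ∸ t ≡ a
    k∸j∸t≡a = trans (ℕP.∸-+-assoc k j t) (trans (cong (k ∸_) (ℕP.+-comm j t)) (sym (ℕP.∸-+-assoc k t j)))

-- The Dehn–Sommerville relations

DehnSommerville : ℕ → (ℕ → ℚ) → Set
DehnSommerville n f = Coords n f F▲ℕ (alt n f)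

dual : ℕ → (ℕ → ℚ) → ℕ → ℚ
dual k f j = sumTo (suc k) (λ t → alt k f t * F▲ℕ t j)

dual-coords : ∀ k f → Coords k (dual k f) F▲ℕ (alt k f)
dual-coords k f .at _ _ = refl

DehnSommerville⇒palindromic : ∀ {n f} → DehnSommerville n f → ∀ j → j ≤ n → f→h n f j ≡ f→h n f (n ∸ j)
DehnSommerville⇒palindromic {n} {f} ds j j≤n = trans (sym (Coords-f→h (f→h-F▲ℕ n) ds .at j j≤n)) (f→h-reverse n f .at j j≤n)

module _ {s : ℕ} {f : ℕ → ℚ} (f-vanishes : ∀ t → s < t → f t ≡ 0ℚ) where

  dual-shift : ∀ {k} → s ≤ k → ∀ j → dual k f j ≡ sgn (k ∸ s) * dual s f j
  dual-shift {k} s≤k j = begin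
    dual k f j                                                    ≡⟨ sumTo-vanishing-tail _ (s≤s s≤k) beyond ⟩
    sumTo (suc s) (λ t → alt k f t * F▲ℕ t j)                     ≡⟨ sumTo-cong (suc s) (λ t t≤s → term t (ℕ.s≤s⁻¹ t≤s)) ⟩
    sumTo (suc s) (λ t → sgn (k ∸ s) * (alt s f t * F▲ℕ t j))     ≡⟨ *-distribˡ-sumTo (suc s) (sgn (k ∸ s)) _ ⟨
    sgn (k ∸ s) * dual s f j                                      ∎
    where
    beyond : ∀ t → suc s ≤ t → t < suc k → alt k f t * F▲ℕ t j ≡ 0ℚ
    beyond t s<t _ = begin
      sgn (k ∸ t) * f t * F▲ℕ t j    ≡⟨ cong (λ x → sgn (k ∸ t) * x * F▲ℕ t j) (f-vanishes t s<t) ⟩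
      sgn (k ∸ t) * 0ℚ * F▲ℕ t j     ≡⟨ cong (_* F▲ℕ t j) (ℚP.*-zeroʳ (sgn (k ∸ t))) ⟩
      0ℚ * F▲ℕ t j                   ≡⟨ ℚP.*-zeroˡ (F▲ℕ t j) ⟩
      0ℚ                             ∎
    term : ∀ t → t ≤ s → alt k f t * F▲ℕ t j ≡ sgn (k ∸ s) * (alt s f t * F▲ℕ t j)
    term t t≤s = begin
      sgn (k ∸ t) * f t * F▲ℕ t j
        ≡⟨ cong (λ x → sgn x * f t * F▲ℕ t j) (trans (cong (_∸ t) (sym (ℕP.m∸n+n≡m s≤k))) (ℕP.+-∸-assoc (k ∸ s) t≤s)) ⟩
      sgn ((k ∸ s) ℕ.+ (s ∸ t)) * f t * F▲ℕ t j
        ≡⟨ cong (λ x → x * f t * F▲ℕ t j) (sgn-+ (k ∸ s) (s ∸ t)) ⟩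
      sgn (k ∸ s) * sgn (s ∸ t) * f t * F▲ℕ t j
        ≡⟨ solve 4 (λ a b x y → a :* b :* x :* y := a :* (b :* x :* y)) refl (sgn (k ∸ s)) (sgn (s ∸ t)) (f t) (F▲ℕ t j) ⟩
      sgn (k ∸ s) * (sgn (s ∸ t) * f t * F▲ℕ t j) ∎

  dual-vanishes : ∀ j → s < j → dual s f j ≡ 0ℚ
  dual-vanishes j s<j = sumTo-zero (suc s) λ t t≤s →
    trans (cong (λ x → alt s f t * ℕ→ℚ x) (k>n⇒nCk≡0 (ℕP.≤-<-trans (ℕ.s≤s⁻¹ t≤s) s<j))) (ℚP.*-zeroʳ (alt s f t))

  module _ {m} (s≤m : s ≤ m) (palindromic : ∀ j → j ≤ m → f→h m f j ≡ sgn (m ∸ s) * f→h m f (m ∸ j)) where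

    palindromic⇒dual-fixed : ∀ j → dual s f j ≡ f j
    palindromic⇒dual-fixed j = [ fixed-below , fixed-above ]′ (ℕP.≤-<-connex j m)
      where
      e : ℚ
      e = sgn (m ∸ s)
      h-coords : Coords m (f→h m f) (H▲ℕ m) (λ t → e * alt m f t)
      h-coords = Coords-congʷ (λ j j≤m → sym (palindromic j j≤m)) (Coords-scale e (f→h-reverse m f))
      f-coords : Coords m f F▲ℕ (λ t → e * alt m f t)
      f-coords = Coords-f→h⁻¹ (f→h-F▲ℕ m) h-coords
      fixed-below : j ≤ m → dual s f j ≡ f j
      fixed-below j≤m = begin
        dual s f j                 ≡⟨ ℚP.*-identityˡ (dual s f j) ⟨
        1ℚ * dual s f j            ≡⟨ cong (_* dual s f j) (sgn*sgn≡1 (m ∸ s)) ⟨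
        e * e * dual s f j         ≡⟨ ℚP.*-assoc e e (dual s f j) ⟩
        e * (e * dual s f j)       ≡⟨ cong (e *_) (dual-shift s≤m j) ⟨
        e * dual m f j             ≡⟨ Coords-scale e (dual-coords m f) .at j j≤m ⟨
        sumTo (suc m) (λ t → e * alt m f t * F▲ℕ t j)
                                   ≡⟨ f-coords .at j j≤m ⟩
        f j                        ∎
      fixed-above : m < j → dual s f j ≡ f j
      fixed-above m<j = trans (dual-vanishes j s<j) (sym (f-vanishes j s<j))
        where
        s<j : s < j
        s<j = ℕP.≤-<-trans s≤m m<j

    palindromic⇒DehnSommerville : ∀ {n} → s ≤ n → sgn (n ∸ s) ≡ 1ℚ → DehnSommerville n f
    palindromic⇒DehnSommerville {n} s≤n even .at j _ = begin
      dual n f j                  ≡⟨ dual-shift s≤n j ⟩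
      sgn (n ∸ s) * dual s f j    ≡⟨ cong (_* dual s f j) even ⟩
      1ℚ * dual s f j             ≡⟨ ℚP.*-identityˡ (dual s f j) ⟩
      dual s f j                  ≡⟨ palindromic⇒dual-fixed j ⟩
      f j                         ∎

count-vanishes : ∀ {m} (Φ : Family m) {t} → size Φ < t → count Φ t ≡ 0
count-vanishes [] _ = refl
count-vanishes (F ∷ Φ) {t} size<t =
  trans (cong (λ b → if b then suc (count Φ t) else count Φ t) (dec-false (∣ F ∣ ℕ.≟ t) ∣F∣≢t))
    (count-vanishes Φ (ℕP.≤-<-trans (ℕP.m≤n⊔m ∣ F ∣ (size Φ)) size<t))
  where
  ∣F∣≢t : ∣ F ∣ ≢ t
  ∣F∣≢t refl = ℕP.<-irrefl refl (ℕP.≤-<-trans (ℕP.m≤m⊔n ∣ F ∣ (size Φ)) size<t)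

fval-vanishes : ∀ {m} (Φ : Family m) t → size Φ < t → fval Φ t ≡ 0ℚ
fval-vanishes Φ t size<t = cong ℕ→ℚ (count-vanishes Φ size<t)

size≤∣⋃∣ : ∀ {m} (Φ : Family m) → size Φ ≤ ∣ ⋃ Φ ∣
size≤∣⋃∣ [] = z≤n
size≤∣⋃∣ (F ∷ Φ) = ℕP.≤-trans (ℕP.⊔-monoʳ-≤ ∣ F ∣ (size≤∣⋃∣ Φ)) (SubsetP.∣p∣⊔∣q∣≤∣p∪q∣ F (⋃ Φ))

∣⋃∣≤η : ∀ {m} (Φ : Family m) → ∣ ⋃ Φ ∣ ≤ η Φ
∣⋃∣≤η Φ with (∣ ⋃ Φ ∣ % 2) ≡ᵇ (size Φ % 2)
... | true = ℕP.≤-refl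
... | false = ℕP.n≤1+n ∣ ⋃ Φ ∣

faceSystem-DehnSommerville : ∀ {m} (Φ : Family m) → IsDS Φ → ∀ n → η Φ ≤ n → n % 2 ≡ size Φ % 2 →
  DehnSommerville n (fval Φ)
faceSystem-DehnSommerville Φ isDS n η≤n n≡s[2] =
  palindromic⇒DehnSommerville (fval-vanishes Φ) size≤m isDS size≤n (sgn-even (n ∸ size Φ) (size Φ) n∸s+s≡s[2])
  where
  size≤m = ℕP.≤-trans (size≤∣⋃∣ Φ) (SubsetP.∣p∣≤n (⋃ Φ))
  size≤n = ℕP.≤-trans (size≤∣⋃∣ Φ) (ℕP.≤-trans (∣⋃∣≤η Φ) η≤n)
  n∸s+s≡s[2] = trans (cong (_% 2) (ℕP.m∸n+n≡m size≤n)) n≡s[2]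

extend : ∀ {k} → (Fin k → ℚ) → ℕ → ℚ
extend {zero} c t = 0ℚ
extend {suc k} c zero = c Fin.zero
extend {suc k} c (suc t) = extend (c ∘ Fin.suc) t

extend-toℕ : ∀ {k} (c : Fin k → ℚ) i → extend c (toℕ i) ≡ c i
extend-toℕ c Fin.zero = refl
extend-toℕ c (Fin.suc i) = extend-toℕ (c ∘ Fin.suc) i

Coords⇒IsCoords : ∀ {n w b c} → Coords n w b c → IsCoords {n} (w ∘ toℕ) (λ i j → b (toℕ i) (toℕ j)) (c ∘ toℕ)
Coords⇒IsCoords {n} {w} {b} {c} hc j = begin
  sumFin (suc n) (λ i → c (toℕ i) * b (toℕ i) (toℕ j))   ≡⟨ sumFin-∑ (suc n) (λ i → c (toℕ i) * b (toℕ i) (toℕ j)) ⟩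
  ∑[ i < suc n ] (c (toℕ i) * b (toℕ i) (toℕ j))         ≡⟨ sumTo-∑ (suc n) (λ t → c t * b t (toℕ j)) ⟨
  sumTo (suc n) (λ t → c t * b t (toℕ j))                ≡⟨ hc .at (toℕ j) (FinP.toℕ≤pred[n] j) ⟩
  w (toℕ j)                                              ∎

IsCoords⇒Coords : ∀ {n w b} {c : Fin (suc n) → ℚ} → IsCoords {n} (w ∘ toℕ) (λ i j → b (toℕ i) (toℕ j)) c → Coords n w b (extend c)
IsCoords⇒Coords {n} {w} {b} {c} hc .at j j≤n = begin
  sumTo (suc n) (λ t → extend c t * b t j)
    ≡⟨ sumTo-∑ (suc n) (λ t → extend c t * b t j) ⟩
  ∑[ i < suc n ] (extend c (toℕ i) * b (toℕ i) j)
    ≡⟨ sum-cong-≗ {suc n} (λ i → cong₂ (λ x y → x * b (toℕ i) y) (extend-toℕ c i) (sym (FinP.toℕ-fromℕ< j<1+n))) ⟩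
  ∑[ i < suc n ] (c i * b (toℕ i) (toℕ (Fin.fromℕ< j<1+n)))
    ≡⟨ sumFin-∑ (suc n) (λ i → c i * b (toℕ i) (toℕ (Fin.fromℕ< j<1+n))) ⟨
  sumFin (suc n) (λ i → c i * b (toℕ i) (toℕ (Fin.fromℕ< j<1+n)))
    ≡⟨ hc (Fin.fromℕ< j<1+n) ⟩
  w (toℕ (Fin.fromℕ< j<1+n))
    ≡⟨ cong w (FinP.toℕ-fromℕ< j<1+n) ⟩
  w j ∎
  where
  j<1+n : j < suc n
  j<1+n = s≤s j≤n

kappaIs : ∀ {n b w c} → Independent n b → Coords n w b c → (l : Fin (suc n)) →
  KappaIs {n} (w ∘ toℕ) (λ i j → b (toℕ i) (toℕ j)) l (c (toℕ l))
kappaIs {c = c} independent hc l =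
    (c ∘ toℕ , Coords⇒IsCoords hc)
  , λ c′ hc′ → trans (sym (extend-toℕ c′ l))
      (Independent⇒coords-unique independent (IsCoords⇒Coords hc′) hc (toℕ l) (FinP.toℕ≤pred[n] l))

mainTheorem9 : (m : ℕ) → 0 < m → (Φ : Family m) → Unique Φ → IsDS Φ → Φ ≢ [] →
    (n : ℕ) → 0 < n → η Φ ≤ n → n % 2 ≡ size Φ % 2 →
    (l : Fin (suc n)) →
      (KappaIs (hvec Φ n) (H▲ n) l (sgn (n ∸ toℕ l) * fval Φ (toℕ l))
        × KappaIs (fvec Φ n) (F▲ n) l (sgn (n ∸ toℕ l) * fval Φ (toℕ l)))
      × (KappaIs (hvec Φ n) (H▼ n) l (hval Φ n (toℕ l))
        × KappaIs (fvec Φ n) (F▼ n) l (hval Φ n (toℕ l))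
        × hval Φ n (toℕ l) ≡ hval Φ n (n ∸ toℕ l))
      × (∃ λ (v : ℚ) → KappaIs (hvec Φ n) (F▲ n) l v × KappaIs (hvec Φ n) (F▼ n) l v)
mainTheorem9 m _ Φ _ isDS _ n _ η≤n n≡s[2] l =
    (kappaIs (H▲ℕ-independent n) h-H▲ l , kappaIs (F▲ℕ-independent n) f-F▲ l)
  , ( kappaIs (H▼ℕ-independent n) h-H▼ l
    , kappaIs (F▼ℕ-independent n) f-F▼ l
    , palindromic (toℕ l) (FinP.toℕ≤pred[n] l) )
  , (c (toℕ l) , kappaIs (F▲ℕ-independent n) h-F▲ l , kappaIs (F▼ℕ-independent n) h-F▼ l)
  where
  f h c : ℕ → ℚ
  f = fval Φ
  h = f→h n f
  f-F▲ : Coords n f F▲ℕ (alt n f)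
  f-F▲ = faceSystem-DehnSommerville Φ isDS n η≤n n≡s[2]
  h-H▲ : Coords n h (H▲ℕ n) (alt n f)
  h-H▲ = Coords-f→h (f→h-F▲ℕ n) f-F▲
  palindromic : ∀ j → j ≤ n → h j ≡ h (n ∸ j)
  palindromic = DehnSommerville⇒palindromic f-F▲
  h-H▼ : Coords n h (H▼ℕ n) h
  h-H▼ = Coords-congᶜ (λ t t≤n → sym (palindromic t t≤n)) (H▼ℕ-coords-reverse n h)
  f-F▼ : Coords n f (F▼ℕ n) h
  f-F▼ = Coords-f→h⁻¹ (f→h-F▼ℕ n) h-H▼
  c = proj₁ (F▲ℕ-coords-exist n h)
  h-F▲ : Coords n h F▲ℕ c
  h-F▲ = proj₂ (F▲ℕ-coords-exist n h)
  h-F▼ : Coords n h (F▼ℕ n) c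
  h-F▼ = Coords-F▼ℕ (Coords-congʷ palindromic h-F▲)
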